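{- For every $n\ge 3$, let $K^*_n$ be the complete graph on $n$ vertices with a loop added at every vertex. In the edge-distinguishing game (EDGe) played on $K^*_n$ (with $\lambda(K^*_n)$ colors), Player 2 has a winning strategy if $n$ is even, and Player 1 has a winning strategy if $n$ is odd.
   Context: For a graph $G$ (here possibly with loops) and a positive integer $k$, a $k$-coloring $c:V(G)\to[k]=\{1,\dots,k\}$ induces the edge coloring $c'(\{u,v\})=\{c(u),c(v)\}$ (a multiset; a loop at $v$ receives $\{c(v),c(v)\}$). $c$ is edge-distinguishing if $c'$ is injective on the edges (including loops), and $\lambda(G)$ is the least $k$ admitting such a coloring. A partial coloring on $U\subseteq V(G)$ has partial induced edge coloring on the edges (including loops) with all endpoints in $U$. EDGe on $G$: two players, Player 1 first, alternately color an uncolored vertex with a color from $[\lambda(G)]$; a move is legal iff afterwards the partial induced edge coloring of the colored vertices is injective. The player making the last legal move wins. A winning strategy guarantees a win regardless of the opponent's play. -}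

module Defs where

open import Data.Nat using (ℕ; _<_)
open import Data.Fin using (Fin; _≟_)
open import Data.Maybe using (Maybe; just; nothing)
open import Data.Product using (_×_; Σ)
open import Data.Sum using (_⊎_)
open import Data.Unit using (⊤)
open import Data.Bool using (if_then_else_)
open import Relation.Nullary using (¬_; does)
open import Relation.Binary.PropositionalEquality using (_≡_)

-- A graph (possibly with loops) on the vertex set Fin n, given by a
-- symmetric adjacency relation; Adj u u means there is a loop at u.
-- An edge is an unordered pair {u , v} with Adj u v.
record Graph : Set₁ where
  field
    n    : ℕ
    Adj  : Fin n → Fin n → Set
    sym  : ∀ {u v} → Adj u v → Adj v u
open Graph public

SamePair : {A : Set} → A → A → A → A → Set
SamePair a b a' b' = (a ≡ a' × b ≡ b') ⊎ (a ≡ b' × b ≡ a')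

KStar : ℕ → Graph
KStar m = record { n = m ; Adj = λ _ _ → ⊤ ; sym = λ _ → _ }

-- a k-coloring c : V → [k]  (colors [k] represented by Fin k) is
-- edge-distinguishing if the induced edge coloring {u,v} ↦ {c u, c v}
-- is injective on edges (including loops)
EdgeDistinguishing : (G : Graph) (k : ℕ) → (Fin (n G) → Fin k) → Set
EdgeDistinguishing G k c =
  ∀ u v u' v' → Adj G u v → Adj G u' v' →
  SamePair (c u) (c v) (c u') (c v') → SamePair u v u' v'

IsLambda : Graph → ℕ → Set
IsLambda G k =
  Σ (Fin (n G) → Fin k) (EdgeDistinguishing G k) ×
  (∀ j → j < k → ¬ Σ (Fin (n G) → Fin j) (EdgeDistinguishing G j))

-- partial colorings: nothing = uncolored
Partial : Graph → ℕ → Set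
Partial G k = Fin (n G) → Maybe (Fin k)

PartialInjective : (G : Graph) (k : ℕ) → Partial G k → Set
PartialInjective G k p =
  ∀ u v u' v' a b a' b' → Adj G u v → Adj G u' v' →
  p u ≡ just a → p v ≡ just b → p u' ≡ just a' → p v' ≡ just b' →
  SamePair a b a' b' → SamePair u v u' v'

update : (G : Graph) (k : ℕ) → Partial G k → Fin (n G) → Fin k → Partial G k
update G k p v a w = if does (w ≟ v) then just a else p w

LegalMove : (G : Graph) (k : ℕ) → Partial G k → Fin (n G) → Fin k → Set
LegalMove G k p v a = (p v ≡ nothing) × PartialInjective G k (update G k p v a)

-- Win p : the player about to move at
-- position p has a winning strategy; Lose p : the player about to move
-- at p loses against optimal play, i.e. the other player has a winning
-- strategy.  The player making the last legal move wins, so a player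
-- with no legal move has lost.
mutual
  data Win (G : Graph) (k : ℕ) (p : Partial G k) : Set where
    win : (v : Fin (n G)) (a : Fin k) → LegalMove G k p v a →
          Lose G k (update G k p v a) → Win G k p

  data Lose (G : Graph) (k : ℕ) (p : Partial G k) : Set where
    lose : ((v : Fin (n G)) (a : Fin k) → LegalMove G k p v a →
            Win G k (update G k p v a)) → Lose G k p

start : (G : Graph) (k : ℕ) → Partial G k
start G k _ = nothing

Player1Wins : Graph → Set
Player1Wins G = ∀ k → IsLambda G k → Win G k (start G k)

Player2Wins : Graph → Set
Player2Wins G = ∀ k → IsLambda G k → Lose G k (start G k)

{-# OPTIONS --safe #-}
-- On a graph with a loop at every vertex the loop {c v , c v} pins down v, so a
-- partial colouring is legal exactly when no colour is used twice. In particular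
-- λ is at least the number n of vertices, and while some vertex is uncoloured
-- fewer than n ≤ λ colours are in use, so a fresh colour is available. Hence
-- every play of EDGe lasts exactly n moves, and the parity of n decides who
-- makes the last one.
module Submission where

open import Defs hiding (sym)
open import Data.Nat using (ℕ; zero; suc; _+_; _≤_; _<_; _%_; s≤s)
open import Data.Nat.Properties using (+-suc; suc-injective; ≤⇒≯; 0≢1+n)
open import Data.Fin using (Fin; zero; suc; punchOut)
open import Data.Fin.Properties using (_≟_; any?; all?; ¬∀⟶∃¬; injective⇒≤; punchOut-injective)
import Data.Fin.Properties as Fin
open import Data.Maybe using (Maybe; just; nothing)
open import Data.Maybe.Properties using (just-injective)
import Data.Maybe.Properties as Maybe
open import Data.Product using (_×_; _,_; proj₁; proj₂; ∃)
open import Data.Sum using (inj₁; inj₂)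
open import Data.Unit using (tt)
open import Data.Empty using (⊥-elim)
open import Function using (_∘_)
open import Relation.Nullary using (Dec; yes; no)
open import Relation.Binary.PropositionalEquality
  using (_≡_; _≢_; refl; sym; trans; cong; cong₂; module ≡-Reasoning)

Looped : Graph → Set
Looped G = ∀ u → Adj G u u

KStar-looped : ∀ m → Looped (KStar m)
KStar-looped m _ = tt

InjectiveOnColoured : ∀ {n} {A : Set} → (Fin n → Maybe A) → Set
InjectiveOnColoured p = ∀ u v {a} → p u ≡ just a → p v ≡ just a → u ≡ v

Unused : ∀ {n} {A : Set} → (Fin n → Maybe A) → A → Set
Unused p a = ∀ w → p w ≢ just a

samePair-diagonal : ∀ {A : Set} {a b : A} → SamePair a a b b → a ≡ b
samePair-diagonal (inj₁ (a≡b , _)) = a≡b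
samePair-diagonal (inj₂ (a≡b , _)) = a≡b

module _ {A : Set} where

  private
    nothing-indicator : Maybe A → ℕ
    nothing-indicator nothing  = 1
    nothing-indicator (just _) = 0

  #uncoloured : ∀ {n} → (Fin n → Maybe A) → ℕ
  #uncoloured {zero}  p = 0
  #uncoloured {suc n} p = nothing-indicator (p zero) + #uncoloured (p ∘ suc)

  #uncoloured-nothing : ∀ n → #uncoloured {n} (λ _ → nothing) ≡ n
  #uncoloured-nothing zero    = refl
  #uncoloured-nothing (suc n) = cong suc (#uncoloured-nothing n)

  #uncoloured-cong : ∀ {n} {p q : Fin n → Maybe A} → (∀ w → p w ≡ q w) →
    #uncoloured p ≡ #uncoloured q
  #uncoloured-cong {zero}  p≗q = refl
  #uncoloured-cong {suc n} p≗q =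
    cong₂ _+_ (cong nothing-indicator (p≗q zero)) (#uncoloured-cong (p≗q ∘ suc))

  #uncoloured-colour : ∀ {n} {p q : Fin n → Maybe A} {v a} →
    p v ≡ nothing → q v ≡ just a → (∀ {w} → w ≢ v → q w ≡ p w) →
    #uncoloured p ≡ suc (#uncoloured q)
  #uncoloured-colour {suc n} {p} {q} {zero} pv qv q≗p rewrite pv | qv =
    cong suc (#uncoloured-cong (λ w → sym (q≗p {suc w} λ ())))
  #uncoloured-colour {suc n} {p} {q} {suc v} pv qv q≗p = begin
    nothing-indicator (p zero) + #uncoloured (p ∘ suc)
      ≡⟨ cong₂ _+_ (cong nothing-indicator (sym (q≗p λ ())))
                   (#uncoloured-colour pv qv (λ w≢v → q≗p (w≢v ∘ Fin.suc-injective))) ⟩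
    nothing-indicator (q zero) + suc (#uncoloured (q ∘ suc))
      ≡⟨ +-suc (nothing-indicator (q zero)) _ ⟩
    suc (#uncoloured q) ∎
    where open ≡-Reasoning

  uncoloured-exists : ∀ {n r} (p : Fin n → Maybe A) → #uncoloured p ≡ suc r →
    ∃ λ v → p v ≡ nothing
  uncoloured-exists {suc n} p #p≡1+r with p zero in p0
  ... | nothing = zero , p0
  ... | just _  = let v , pv = uncoloured-exists (p ∘ suc) #p≡1+r in suc v , pv

module _ {k : ℕ} where

  allColoursUsed⇒<order : ∀ {n} {p : Fin n → Maybe (Fin k)} {v} →
    p v ≡ nothing → (∀ a → ∃ λ w → p w ≡ just a) → k < n
  allColoursUsed⇒<order {suc n} {p} {v} pv used = s≤s (injective⇒≤ user-injective)
    where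
    user≢v : ∀ a → v ≢ proj₁ (used a)
    user≢v a refl with trans (sym pv) (proj₂ (used a))
    ... | ()
    user-injective : ∀ {a b} → punchOut (user≢v a) ≡ punchOut (user≢v b) → a ≡ b
    user-injective {a} {b} eq = just-injective (begin
      just a             ≡⟨ sym (proj₂ (used a)) ⟩
      p (proj₁ (used a)) ≡⟨ cong p (punchOut-injective (user≢v a) (user≢v b) eq) ⟩
      p (proj₁ (used b)) ≡⟨ proj₂ (used b) ⟩
      just b             ∎)
      where open ≡-Reasoning

  used? : ∀ {n} (p : Fin n → Maybe (Fin k)) a → Dec (∃ λ w → p w ≡ just a)
  used? p a = any? (λ w → Maybe.≡-dec _≟_ (p w) (just a))

  fresh-colour : ∀ {n} {p : Fin n → Maybe (Fin k)} {v} →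
    n ≤ k → p v ≡ nothing → ∃ (Unused p)
  fresh-colour {p = p} n≤k pv with all? (used? p)
  ... | yes used = ⊥-elim (≤⇒≯ n≤k (allColoursUsed⇒<order pv used))
  ... | no ¬used = let a , a-unused = ¬∀⟶∃¬ k _ (used? p) ¬used in a , λ w pw → a-unused (w , pw)

module _ (G : Graph) (k : ℕ) where

  injectiveOnColoured⇒partialInjective : ∀ {p : Partial G k} →
    InjectiveOnColoured p → PartialInjective G k p
  injectiveOnColoured⇒partialInjective inj u v u' v' a b a' b' _ _ pu pv pu' pv'
    (inj₁ (refl , refl)) = inj₁ (inj u u' pu pu' , inj v v' pv pv')
  injectiveOnColoured⇒partialInjective inj u v u' v' a b a' b' _ _ pu pv pu' pv'
    (inj₂ (refl , refl)) = inj₂ (inj u v' pu pv' , inj v u' pv pu')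

  partialInjective⇒injectiveOnColoured : Looped G → ∀ {p : Partial G k} →
    PartialInjective G k p → InjectiveOnColoured p
  partialInjective⇒injectiveOnColoured looped pinj u v {a} pu pv =
    samePair-diagonal
      (pinj u u v v a a a a (looped u) (looped v) pu pu pv pv (inj₁ (refl , refl)))

  edgeDistinguishing⇒injective : Looped G → ∀ {c : Fin (n G) → Fin k} →
    EdgeDistinguishing G k c → ∀ {u v} → c u ≡ c v → u ≡ v
  edgeDistinguishing⇒injective looped ed {u} {v} cu≡cv =
    samePair-diagonal (ed u u v v (looped u) (looped v) (inj₁ (cu≡cv , cu≡cv)))

  order≤λ : Looped G → IsLambda G k → n G ≤ k
  order≤λ looped ((c , ed) , _) = injective⇒≤ (edgeDistinguishing⇒injective looped ed)

  module _ {p : Partial G k} {v : Fin (n G)} {a : Fin k} where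

    update-self : update G k p v a v ≡ just a
    update-self with v ≟ v
    ... | yes _   = refl
    ... | no v≢v = ⊥-elim (v≢v refl)

    update-other : ∀ {w} → w ≢ v → update G k p v a w ≡ p w
    update-other {w} w≢v with w ≟ v
    ... | yes w≡v = ⊥-elim (w≢v w≡v)
    ... | no _    = refl

    update-injective : InjectiveOnColoured p → Unused p a →
      InjectiveOnColoured (update G k p v a)
    update-injective inj unused u w qu qw with u ≟ v | w ≟ v
    ... | yes u≡v | yes w≡v = trans u≡v (sym w≡v)
    ... | yes _   | no _    = ⊥-elim (unused w (trans qw (sym qu)))
    ... | no _    | yes _   = ⊥-elim (unused u (trans qu (sym qw)))
    ... | no _    | no _    = inj u w qu qw

    #uncoloured-update : p v ≡ nothing → #uncoloured p ≡ suc (#uncoloured (update G k p v a))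
    #uncoloured-update pv = #uncoloured-colour pv update-self update-other

mutual
  data Even : ℕ → Set where
    zero : Even zero
    suc  : ∀ {n} → Odd n → Even (suc n)

  data Odd : ℕ → Set where
    suc : ∀ {n} → Even n → Odd (suc n)

%2≡0⇒Even : ∀ m → m % 2 ≡ 0 → Even m
%2≡0⇒Even zero          _ = zero
%2≡0⇒Even (suc (suc m)) e = suc (suc (%2≡0⇒Even m e))

%2≡1⇒Odd : ∀ m → m % 2 ≡ 1 → Odd m
%2≡1⇒Odd (suc zero)    _ = suc zero
%2≡1⇒Odd (suc (suc m)) e = suc (suc (%2≡1⇒Odd m e))

module _ (G : Graph) (looped : Looped G) {k : ℕ} (n≤k : n G ≤ k) where

  private
    remaining : ∀ {p : Partial G k} {v a r} → p v ≡ nothing → #uncoloured p ≡ suc r →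
      #uncoloured (update G k p v a) ≡ r
    remaining pv #p≡1+r = suc-injective (trans (sym (#uncoloured-update G k pv)) #p≡1+r)

  mutual
    odd-uncoloured⇒Win : ∀ {r} (p : Partial G k) → InjectiveOnColoured p →
      #uncoloured p ≡ r → Odd r → Win G k p
    odd-uncoloured⇒Win p inj #p≡1+r (suc even) =
      let v , pv     = uncoloured-exists p #p≡1+r
          a , unused = fresh-colour n≤k pv
          inj′       = update-injective G k inj unused
      in win v a (pv , injectiveOnColoured⇒partialInjective G k inj′)
             (even-uncoloured⇒Lose _ (remaining pv #p≡1+r) even)

    even-uncoloured⇒Lose : ∀ {r} (p : Partial G k) → #uncoloured p ≡ r → Even r → Lose G k p
    even-uncoloured⇒Lose p #p≡0 zero =
      lose λ v a (pv , _) → ⊥-elim (0≢1+n (trans (sym #p≡0) (#uncoloured-update G k {a = a} pv)))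
    even-uncoloured⇒Lose p #p≡1+r (suc odd) =
      lose λ v a (pv , pinj) →
        odd-uncoloured⇒Win _ (partialInjective⇒injectiveOnColoured G k looped pinj)
          (remaining pv #p≡1+r) odd

looped-outcome : ∀ G → Looped G → ∀ {k} → IsLambda G k →
  (Even (n G) → Lose G k (start G k)) × (Odd (n G) → Win G k (start G k))
looped-outcome G looped {k} isλ =
    even-uncoloured⇒Lose G looped n≤k (start G k) (#uncoloured-nothing {Fin k} (n G))
  , odd-uncoloured⇒Win G looped n≤k (start G k) (λ _ _ ()) (#uncoloured-nothing {Fin k} (n G))
  where n≤k = order≤λ G k looped isλ

-- The hypothesis 3 ≤ m is unused: the argument covers every looped graph.
theorem4p1 : (m : ℕ) → 3 ≤ m →
    (m % 2 ≡ 0 → Player2Wins (KStar m)) × (m % 2 ≡ 1 → Player1Wins (KStar m))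
theorem4p1 m _ =
    (λ m-even k isλ → proj₁ (looped-outcome (KStar m) (KStar-looped m) isλ) (%2≡0⇒Even m m-even))
  , (λ m-odd  k isλ → proj₂ (looped-outcome (KStar m) (KStar-looped m) isλ) (%2≡1⇒Odd m m-odd))
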